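{- We have \[ \sum_{n\ge 0} NCP_2(n)\,x^n = \frac{3-3x-\sqrt{1-6x+5x^2}}{2(1-x)} = \frac32-\frac12\sqrt{\frac{1-5x}{1-x}} = 1+x+2x^2+5x^3+15x^4+51x^5+188x^6+731x^7+2950x^8+\cdots. \]
   Context: A set partition of $[n]$ is a set of disjoint nonempty blocks with union $[n]=\{1,\dots,n\}$. An edge of a partition $\pi$ is a pair $(i,j)$ such that either $i<j$, $i,j$ lie in the same block and no element of that block lies strictly between them; or $i=j$ and $\{i\}$ is a block. For $k\ge 0$, a $k$-distant crossing of $\pi$ is a pair of edges $(i_1,j_1),(i_2,j_2)$ with $i_1<i_2\le j_1<j_2$ and $j_1-i_2\ge k$; $\pi$ is $k$-distant noncrossing if it has none. $NCP_k(n)$ denotes the number of $k$-distant noncrossing partitions of $[n]$, with $NCP_k(0)=1$. -}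

module Defs where

open import Data.Nat using (ℕ; zero; suc; _∸_; _≡ᵇ_; _<ᵇ_; _≤ᵇ_)
open import Data.Bool using (Bool; true; false; not; _∧_; _∨_; if_then_else_)
open import Data.List using (List; []; _∷_; map; concatMap; upTo; length; filterᵇ; foldr)
open import Data.Product using (_×_; _,_)
open import Data.Integer as ℤ using (ℤ; +_)

-- A set partition of [n] = {1,…,n} is encoded (bijectively) by its
-- restricted growth string: a list p of length n where p[i] is the index
-- of the block containing element i+1, blocks being numbered 0,1,2,…
-- in order of their least elements.  Positions 0..n-1 stand for the
-- elements 1..n (a uniform shift, irrelevant for the crossing condition).

-- rgsGo k m : all continuations of length k when m blocks are already open.
rgsGo : ℕ → ℕ → List (List ℕ)
rgsGo zero    m = [] ∷ []
rgsGo (suc k) m =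
  concatMap (λ c → map (c ∷_) (rgsGo k (if c ≡ᵇ m then suc m else m)))
            (upTo (suc m))

setPartitions : ℕ → List (List ℕ)
setPartitions n = rgsGo n 0

allB : {A : Set} → (A → Bool) → List A → Bool
allB f = foldr (λ a b → f a ∧ b) true

anyB : {A : Set} → (A → Bool) → List A → Bool
anyB f = foldr (λ a b → f a ∨ b) false

at : List ℕ → ℕ → ℕ
at []       _       = 0
at (x ∷ xs) zero    = x
at (x ∷ xs) (suc i) = at xs i

sameBlock : List ℕ → ℕ → ℕ → Bool
sameBlock p i j = at p i ≡ᵇ at p j

isEdge : List ℕ → ℕ → ℕ → Bool
isEdge p i j =
  ((i <ᵇ j) ∧ sameBlock p i j
     ∧ allB (λ m → not ((i <ᵇ m) ∧ (m <ᵇ j) ∧ sameBlock p i m)) (upTo (length p)))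
  ∨ ((i ≡ᵇ j) ∧ allB (λ m → (m ≡ᵇ i) ∨ not (sameBlock p i m)) (upTo (length p)))

edges : List ℕ → List (ℕ × ℕ)
edges p = filterᵇ (λ { (i , j) → isEdge p i j })
                  (concatMap (λ i → map (i ,_) (upTo (length p))) (upTo (length p)))

kCrossing : ℕ → ℕ × ℕ → ℕ × ℕ → Bool
kCrossing k (i₁ , j₁) (i₂ , j₂) =
  (i₁ <ᵇ i₂) ∧ (i₂ ≤ᵇ j₁) ∧ (j₁ <ᵇ j₂) ∧ (k ≤ᵇ (j₁ ∸ i₂))

kNoncrossing : ℕ → List ℕ → Bool
kNoncrossing k p =
  not (anyB (λ e₁ → anyB (λ e₂ → kCrossing k e₁ e₂) (edges p)) (edges p))

NCP : ℕ → ℕ → ℕ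
NCP k n = length (filterᵇ (kNoncrossing k) (setPartitions n))

FPS : Set
FPS = ℕ → ℤ

sumℤ : List ℤ → ℤ
sumℤ = foldr ℤ._+_ (+ 0)

_⋆_ : FPS → FPS → FPS
(f ⋆ g) n = sumℤ (map (λ i → f i ℤ.* g (n ∸ i)) (upTo (suc n)))

_⊕_ : FPS → FPS → FPS
(f ⊕ g) n = f n ℤ.+ g n

_⊝_ : FPS → FPS → FPS
(f ⊝ g) n = f n ℤ.- g n

_·_ : ℤ → FPS → FPS
(c · f) n = c ℤ.* f n

const : ℤ → FPS
const c zero    = c
const c (suc n) = + 0

X : FPS
X 1 = + 1
X _ = + 0

genNCP : ℕ → FPS
genNCP k n = + NCP k n

module Submission where

-- Read a partition as its restricted growth word and call a block open when
-- reusing it next creates no 2-distant crossing.  The open blocks form a stack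
-- ordered by last use: a new block is pushed, reusing the top leaves the stack
-- unchanged, and reusing a deeper block c closes every block strictly between
-- the top and c.  So the number of crossing-free completions depends only on the
-- height r of the stack, and the generating functions of these counts are
-- G_{r+1} = P B^r where P = 1 + x (P + P B) and B = 1 + x P B.  With u = x P the
-- series of the theorem is F = 1 + u, and the two equations give
-- (1 - x) u (1 - u) = x, whence (1 - x)(3 - 2F)² = (1 - x)(1 - 2u)² = 1 - 5x.

open import Defs

module Counting where

  open import Data.Nat
  open import Data.Nat.Properties
  open import Data.Bool using (Bool; true; false; not; _∧_; _∨_; T; if_then_else_)
  open import Data.Bool.Properties using (T-∧; T-∨; ∨-assoc)
  open import Data.List using (List; []; _∷_; map; upTo; concatMap; length; filterᵇ; applyUpTo; _++_; concat)
  open import Data.Product using (_×_; _,_; ∃; ∃-syntax; proj₁; proj₂)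
  open import Data.Sum using (_⊎_; inj₁; inj₂)
  open import Data.List.Properties using (length-++-≤ˡ; length-++; map-++; ++-assoc; ++-identityʳ; upTo-∷ʳ; map-cong; map-cong-local; filter-++; filter-none)
  open import Data.List.Relation.Unary.All.Properties using (applyUpTo⁺₁)
  open import Data.Nat.ListAction using (sum)
  open import Data.Nat.ListAction.Properties using (sum-++)
  open import Algebra.Properties.CommutativeSemigroup +-commutativeSemigroup using (interchange)
  open import Relation.Nullary.Decidable using (does; dec-true; dec-false)
  open import Relation.Nullary.Decidable.Core using (T?)
  open import Relation.Binary.Definitions using (tri<; tri≈; tri>)
  open import Relation.Nullary using (¬_; contradiction; yes; no)
  open import Data.Unit using (⊤; tt)
  open import Data.List.Relation.Unary.All as All using (All; []; _∷_)
  open import Data.List.Relation.Unary.Any using (here; there)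
  open import Data.List.Relation.Unary.AllPairs using (AllPairs; []; _∷_)
  open import Data.List.Membership.Propositional using (_∈_; _∉_)
  open import Data.List.Membership.DecPropositional _≟_ using (_∈?_)
  open import Relation.Binary.PropositionalEquality
  open ≡-Reasoning
  open import Function using (_∘_; id)
  open import Function.Bundles using (Equivalence)
  open Equivalence using (to; from)

  T-not⁻ : ∀ {a} → T (not a) → ¬ T a
  T-not⁻ {true} ()

  T-not⁺ : ∀ {a} → ¬ T a → T (not a)
  T-not⁺ {true}  ¬t = ¬t _
  T-not⁺ {false} _  = _

  ≡ᵇ-refl : ∀ n → (n ≡ᵇ n) ≡ true
  ≡ᵇ-refl n = dec-true (n ≟ n) refl

  ≢⇒≡ᵇ-false : ∀ {m n} → m ≢ n → (m ≡ᵇ n) ≡ false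
  ≢⇒≡ᵇ-false {m} {n} = dec-false (m ≟ n)

  anyB-applyUpTo⁻ : ∀ {A : Set} (f : A → Bool) (g : ℕ → A) n →
                    T (anyB f (applyUpTo g n)) → ∃[ i ] i < n × T (f (g i))
  anyB-applyUpTo⁻ f g (suc n) t with to T-∨ t
  ... | inj₁ t₀ = 0 , z<s , t₀
  ... | inj₂ t′ with anyB-applyUpTo⁻ f (g ∘ suc) n t′
  ...   | i , i<n , tᵢ = suc i , s<s i<n , tᵢ

  anyB-applyUpTo⁺ : ∀ {A : Set} (f : A → Bool) (g : ℕ → A) n i →
                    i < n → T (f (g i)) → T (anyB f (applyUpTo g n))
  anyB-applyUpTo⁺ f g (suc n) zero    _         t = from T-∨ (inj₁ t)
  anyB-applyUpTo⁺ f g (suc n) (suc i) (s<s i<n) t = from T-∨ (inj₂ (anyB-applyUpTo⁺ f (g ∘ suc) n i i<n t))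

  allB-applyUpTo⁻ : ∀ {A : Set} (f : A → Bool) (g : ℕ → A) n →
                    T (allB f (applyUpTo g n)) → ∀ i → i < n → T (f (g i))
  allB-applyUpTo⁻ f g (suc n) t zero    _         = proj₁ (to T-∧ t)
  allB-applyUpTo⁻ f g (suc n) t (suc i) (s<s i<n) = allB-applyUpTo⁻ f (g ∘ suc) n (proj₂ (to T-∧ t)) i i<n

  allB-applyUpTo⁺ : ∀ {A : Set} (f : A → Bool) (g : ℕ → A) n →
                    (∀ i → i < n → T (f (g i))) → T (allB f (applyUpTo g n))
  allB-applyUpTo⁺ f g zero    h = _
  allB-applyUpTo⁺ f g (suc n) h =
    from T-∧ (h 0 z<s , allB-applyUpTo⁺ f (g ∘ suc) n (λ i i<n → h (suc i) (s<s i<n)))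

  anyB-cong : ∀ {A : Set} {f g : A → Bool} → (∀ x → f x ≡ g x) → ∀ xs → anyB f xs ≡ anyB g xs
  anyB-cong f≗g []       = refl
  anyB-cong f≗g (x ∷ xs) = cong₂ _∨_ (f≗g x) (anyB-cong f≗g xs)

  anyB-filterᵇ : ∀ {A : Set} (f e : A → Bool) xs → anyB f (filterᵇ e xs) ≡ anyB (λ x → e x ∧ f x) xs
  anyB-filterᵇ f e [] = refl
  anyB-filterᵇ f e (x ∷ xs) with e x
  ... | true  = cong (f x ∨_) (anyB-filterᵇ f e xs)
  ... | false = anyB-filterᵇ f e xs

  anyB-++ : ∀ {A : Set} (f : A → Bool) xs ys → anyB f (xs ++ ys) ≡ anyB f xs ∨ anyB f ys
  anyB-++ f []       ys = refl
  anyB-++ f (x ∷ xs) ys = trans (cong (f x ∨_) (anyB-++ f xs ys)) (sym (∨-assoc (f x) _ _))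

  anyB-concatMap : ∀ {A B : Set} (f : B → Bool) (h : A → List B) xs →
                   anyB f (concatMap h xs) ≡ anyB (anyB f ∘ h) xs
  anyB-concatMap f h []       = refl
  anyB-concatMap f h (x ∷ xs) =
    trans (anyB-++ f (h x) (concat (map h xs))) (cong (anyB f (h x) ∨_) (anyB-concatMap f h xs))

  anyB-map : ∀ {A B : Set} (f : B → Bool) (h : A → B) xs → anyB f (map h xs) ≡ anyB (f ∘ h) xs
  anyB-map f h []       = refl
  anyB-map f h (x ∷ xs) = cong (f (h x) ∨_) (anyB-map f h xs)

  -- The edges (i , i) of singleton blocks can never take part in a 2-distant
  -- crossing, so only the arcs i < j matter.
  record Arc (p : List ℕ) (i j : ℕ) : Set where
    constructor arc
    field
      i<j  : i < j
      j<∣p∣ : j < length p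
      same : at p i ≡ at p j
      gap  : ∀ m → i < m → m < j → at p m ≢ at p i
  open Arc public

  record Crossing (p : List ℕ) : Set where
    constructor crossing
    field
      {i₁ j₁ i₂ j₂} : ℕ
      arc₁ : Arc p i₁ j₁
      arc₂ : Arc p i₂ j₂
      i₁<i₂   : i₁ < i₂
      i₂+2≤j₁ : i₂ + 2 ≤ j₁
      j₁<j₂   : j₁ < j₂

  noArcInterior : List ℕ → ℕ → ℕ → Bool
  noArcInterior p i j = allB (λ m → not ((i <ᵇ m) ∧ (m <ᵇ j) ∧ sameBlock p i m)) (upTo (length p))

  isEdge⇒Arc : ∀ p i j → i < j → j < length p → T (isEdge p i j) → Arc p i j
  isEdge⇒Arc p i j i<j j<∣p∣ t with to (T-∨ {(i <ᵇ j) ∧ sameBlock p i j ∧ noArcInterior p i j}) t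
  ... | inj₂ singleton = contradiction (≡ᵇ⇒≡ i j (proj₁ (to (T-∧ {i ≡ᵇ j}) singleton))) (<⇒≢ i<j)
  ... | inj₁ t′ = arc i<j j<∣p∣ (≡ᵇ⇒≡ _ _ (proj₁ sameAndGap)) gapOk
    where
    sameAndGap = to (T-∧ {sameBlock p i j}) (proj₂ (to (T-∧ {i <ᵇ j}) t′))
    gapOk : ∀ m → i < m → m < j → at p m ≢ at p i
    gapOk m i<m m<j eq =
      T-not⁻ (allB-applyUpTo⁻ _ id (length p) (proj₂ sameAndGap) m (<-trans m<j j<∣p∣))
             (from T-∧ (<⇒<ᵇ i<m , from T-∧ (<⇒<ᵇ m<j , ≡⇒≡ᵇ _ _ (sym eq))))

  Arc⇒isEdge : ∀ {p i j} → Arc p i j → T (isEdge p i j)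
  Arc⇒isEdge {p} {i} {j} (arc i<j j<∣p∣ same gap) =
    from T-∨ (inj₁ (from T-∧ (<⇒<ᵇ i<j , from T-∧ (≡⇒≡ᵇ _ _ same ,
      allB-applyUpTo⁺ _ id (length p) λ m _ → T-not⁺ λ t →
        let (i<m , t′) = to T-∧ t ; (m<j , sm) = to T-∧ t′
        in gap m (<ᵇ⇒< i m i<m) (<ᵇ⇒< m j m<j) (sym (≡ᵇ⇒≡ _ _ sm))))))

  anyB-edges : (p : List ℕ) (g : ℕ × ℕ → Bool) →
               anyB g (edges p) ≡ anyB (λ i → anyB (λ j → isEdge p i j ∧ g (i , j)) (upTo (length p))) (upTo (length p))
  anyB-edges p g =
    trans (anyB-filterᵇ g _ pairs)
      (trans (anyB-concatMap _ (λ i → map (i ,_) (upTo (length p))) (upTo (length p)))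
             (anyB-cong (λ i → anyB-map _ (i ,_) (upTo (length p))) (upTo (length p))))
    where pairs = concatMap (λ i → map (i ,_) (upTo (length p))) (upTo (length p))

  anyB-edges⁻ : (p : List ℕ) (g : ℕ × ℕ → Bool) → T (anyB g (edges p)) →
                ∃[ i ] ∃[ j ] j < length p × T (isEdge p i j) × T (g (i , j))
  anyB-edges⁻ p g t with anyB-applyUpTo⁻ _ id (length p) (subst T (anyB-edges p g) t)
  ... | i , _ , t′ with anyB-applyUpTo⁻ _ id (length p) t′
  ...   | j , j<∣p∣ , t″ = i , j , j<∣p∣ , to T-∧ t″

  anyB-edges⁺ : ∀ {p} (g : ℕ × ℕ → Bool) {i j} → Arc p i j → T (g (i , j)) → T (anyB g (edges p))
  anyB-edges⁺ {p} g {i} {j} a gt = subst T (sym (anyB-edges p g))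
    (anyB-applyUpTo⁺ _ id (length p) i (<-trans (i<j a) (j<∣p∣ a))
      (anyB-applyUpTo⁺ _ id (length p) j (j<∣p∣ a) (from T-∧ (Arc⇒isEdge a , gt))))

  hasCrossing : List ℕ → Bool
  hasCrossing p = anyB (λ e₁ → anyB (kCrossing 2 e₁) (edges p)) (edges p)

  hasCrossing⇒Crossing : ∀ p → T (hasCrossing p) → Crossing p
  hasCrossing⇒Crossing p t with anyB-edges⁻ p _ t
  ... | i₁ , j₁ , j₁<∣p∣ , e₁ , t′ with anyB-edges⁻ p _ t′
  ...   | i₂ , j₂ , j₂<∣p∣ , e₂ , t″ =
    crossing (isEdge⇒Arc p i₁ j₁ (<-≤-trans i₁<i₂ i₂≤j₁) j₁<∣p∣ e₁)
             (isEdge⇒Arc p i₂ j₂ (≤-<-trans i₂≤j₁ j₁<j₂) j₂<∣p∣ e₂)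
             i₁<i₂ (subst (_≤ j₁) (+-comm 2 i₂) (m≤o∸n⇒m+n≤o 2 i₂≤j₁ 2≤j₁∸i₂)) j₁<j₂
    where
    c₁ = to T-∧ t″
    c₂ = to T-∧ (proj₂ c₁)
    c₃ = to T-∧ (proj₂ c₂)
    i₁<i₂ = <ᵇ⇒< i₁ i₂ (proj₁ c₁)
    i₂≤j₁ = ≤ᵇ⇒≤ i₂ j₁ (proj₁ c₂)
    j₁<j₂ = <ᵇ⇒< j₁ j₂ (proj₁ c₃)
    2≤j₁∸i₂ = ≤ᵇ⇒≤ 2 (j₁ ∸ i₂) (proj₂ c₃)

  Crossing⇒hasCrossing : ∀ {p} → Crossing p → T (hasCrossing p)
  Crossing⇒hasCrossing (crossing {j₁ = j₁} {i₂ = i₂} a₁ a₂ i₁<i₂ i₂+2≤j₁ j₁<j₂) =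
    anyB-edges⁺ _ a₁ (anyB-edges⁺ _ a₂
      (from T-∧ (<⇒<ᵇ i₁<i₂ , from T-∧ (≤⇒≤ᵇ (≤-trans (m≤m+n i₂ 2) i₂+2≤j₁) ,
        from T-∧ (<⇒<ᵇ j₁<j₂ , ≤⇒≤ᵇ (m+n≤o⇒m≤o∸n 2 (subst (_≤ j₁) (+-comm i₂ 2) i₂+2≤j₁)))))))

  ¬Crossing⇒kNoncrossing : ∀ {p} → ¬ Crossing p → kNoncrossing 2 p ≡ true
  ¬Crossing⇒kNoncrossing {p} ¬c with hasCrossing p in eq
  ... | false = refl
  ... | true  = contradiction (hasCrossing⇒Crossing p (subst T (sym eq) _)) ¬c

  Crossing⇒kNoncrossing-false : ∀ {p} → Crossing p → kNoncrossing 2 p ≡ false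
  Crossing⇒kNoncrossing-false {p} c with hasCrossing p in eq
  ... | true  = refl
  ... | false = contradiction (subst T eq (Crossing⇒hasCrossing c)) λ ()

  -- Extending a word by one letter

  length-∷ʳ : ∀ (p : List ℕ) c → length (p ++ c ∷ []) ≡ suc (length p)
  length-∷ʳ []      c = refl
  length-∷ʳ (x ∷ p) c = cong suc (length-∷ʳ p c)

  <-length-∷ʳ⁻ : ∀ (p : List ℕ) c {j} → j < length (p ++ c ∷ []) → j < length p ⊎ j ≡ length p
  <-length-∷ʳ⁻ p c j< = m≤n⇒m<n∨m≡n (s≤s⁻¹ (subst (_ <_) (length-∷ʳ p c) j<))

  length<length-∷ʳ : ∀ (p : List ℕ) c → length p < length (p ++ c ∷ [])
  length<length-∷ʳ p c = subst (length p <_) (sym (length-∷ʳ p c)) ≤-refl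

  at-++ˡ : ∀ (p q : List ℕ) {i} → i < length p → at (p ++ q) i ≡ at p i
  at-++ˡ (x ∷ p) q {zero}  _         = refl
  at-++ˡ (x ∷ p) q {suc i} (s<s i<∣p∣) = at-++ˡ p q i<∣p∣

  at-length : ∀ (p q : List ℕ) c → at (p ++ c ∷ q) (length p) ≡ c
  at-length []      q c = refl
  at-length (x ∷ p) q c = at-length p q c

  Arc-++ : ∀ {p} q {i j} → Arc p i j → Arc (p ++ q) i j
  Arc-++ {p} q (arc i<j j<∣p∣ same gap) =
    arc i<j (<-≤-trans j<∣p∣ (length-++-≤ˡ p))
        (trans (at-++ˡ p q i<∣p∣) (trans same (sym (at-++ˡ p q j<∣p∣))))
        (λ m i<m m<j eq → gap m i<m m<j
          (trans (sym (at-++ˡ p q (<-trans m<j j<∣p∣))) (trans eq (at-++ˡ p q i<∣p∣))))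
    where i<∣p∣ = <-trans i<j j<∣p∣

  Crossing-++ : ∀ {p} q → Crossing p → Crossing (p ++ q)
  Crossing-++ q (crossing a₁ a₂ c₁ c₂ c₃) = crossing (Arc-++ q a₁) (Arc-++ q a₂) c₁ c₂ c₃

  record LastOcc (p : List ℕ) (x s : ℕ) : Set where
    constructor lastOcc
    field
      s<∣p∣  : s < length p
      at-s  : at p s ≡ x
      after : ∀ m → s < m → m < length p → at p m ≢ x
  open LastOcc public

  LastOcc-unique : ∀ {p x s s′} → LastOcc p x s → LastOcc p x s′ → s ≡ s′
  LastOcc-unique {s = s} {s′} l l′ with <-cmp s s′
  ... | tri≈ _ s≡s′ _ = s≡s′
  ... | tri< s<s′ _ _ = contradiction (at-s l′) (after l s′ s<s′ (s<∣p∣ l′))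
  ... | tri> _ _ s′<s = contradiction (at-s l) (after l′ s s′<s (s<∣p∣ l))

  LastOcc-∷ʳ-self : ∀ p c → LastOcc (p ++ c ∷ []) c (length p)
  LastOcc-∷ʳ-self p c = lastOcc (length<length-∷ʳ p c) (at-length p [] c)
    λ m ∣p∣<m m<∣pc∣ → contradiction (<-≤-trans ∣p∣<m (s≤s⁻¹ (subst (m <_) (length-∷ʳ p c) m<∣pc∣))) (<-irrefl refl)

  LastOcc-∷ʳ⁺ : ∀ p c {x s} → x ≢ c → LastOcc p x s → LastOcc (p ++ c ∷ []) x s
  LastOcc-∷ʳ⁺ p c {x} {s} x≢c (lastOcc s<∣p∣ at-s after) =
    lastOcc (<-≤-trans s<∣p∣ (length-++-≤ˡ p)) (trans (at-++ˡ p _ s<∣p∣) at-s) after′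
    where
    after′ : ∀ m → s < m → m < length (p ++ c ∷ []) → at (p ++ c ∷ []) m ≢ x
    after′ m s<m m< eq with <-length-∷ʳ⁻ p c m<
    ... | inj₁ m<∣p∣ = after m s<m m<∣p∣ (trans (sym (at-++ˡ p _ m<∣p∣)) eq)
    ... | inj₂ refl  = x≢c (trans (sym eq) (at-length p [] c))

  LastOcc-∷ʳ⁻ : ∀ p c {x s} → x ≢ c → LastOcc (p ++ c ∷ []) x s → LastOcc p x s
  LastOcc-∷ʳ⁻ p c {x} {s} x≢c (lastOcc s< at-s after) with <-length-∷ʳ⁻ p c s<
  ... | inj₂ refl    = contradiction (trans (sym at-s) (at-length p [] c)) x≢c
  ... | inj₁ s<∣p∣ = lastOcc s<∣p∣ (trans (sym (at-++ˡ p _ s<∣p∣)) at-s)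
        λ m s<m m<∣p∣ eq → after m s<m (<-≤-trans m<∣p∣ (length-++-≤ˡ p)) (trans (at-++ˡ p _ m<∣p∣) eq)

  LastOcc-∷ʳ-self-unique : ∀ p c {s} → LastOcc (p ++ c ∷ []) c s → s ≡ length p
  LastOcc-∷ʳ-self-unique p c l = LastOcc-unique l (LastOcc-∷ʳ-self p c)

  Arc-∷ʳ⁻ : ∀ p c {i j} → Arc (p ++ c ∷ []) i j → Arc p i j ⊎ (j ≡ length p × LastOcc p c i)
  Arc-∷ʳ⁻ p c {i} {j} (arc i<j j< same gap) with <-length-∷ʳ⁻ p c j<
  ... | inj₁ j<∣p∣ = inj₁ (arc i<j j<∣p∣
          (trans (sym (at-++ˡ p _ i<∣p∣)) (trans same (at-++ˡ p _ j<∣p∣)))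
          λ m i<m m<j eq → gap m i<m m<j
            (trans (at-++ˡ p _ (<-trans m<j j<∣p∣)) (trans eq (sym (at-++ˡ p _ i<∣p∣)))))
    where i<∣p∣ = <-trans i<j j<∣p∣
  ... | inj₂ refl = inj₂ (refl , lastOcc i<j (trans (sym (at-++ˡ p _ i<j)) (trans same (at-length p [] c)))
          λ m i<m m<∣p∣ eq → gap m i<m m<∣p∣
            (trans (at-++ˡ p _ m<∣p∣) (trans eq (trans (sym (at-length p [] c)) (sym same)))))

  LastOcc⇒Arc-∷ʳ : ∀ p c {s} → LastOcc p c s → Arc (p ++ c ∷ []) s (length p)
  LastOcc⇒Arc-∷ʳ p c {s} (lastOcc s<∣p∣ at-s after) =
    arc s<∣p∣ (length<length-∷ʳ p c)
        (trans (at-++ˡ p _ s<∣p∣) (trans at-s (sym (at-length p [] c))))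
        λ m s<m m<∣p∣ eq → after m s<m m<∣p∣
          (trans (sym (at-++ˡ p _ m<∣p∣)) (trans eq (trans (at-++ˡ p _ s<∣p∣) at-s)))

  -- Appending a letter whose previous occurrence is at s creates a 2-distant
  -- crossing exactly when s is blocked.
  Blocked : List ℕ → ℕ → Set
  Blocked p s = ∃[ i ] ∃[ j ] Arc p i j × i < s × s + 2 ≤ j

  Blocked-++ : ∀ {p} q {s} → Blocked p s → Blocked (p ++ q) s
  Blocked-++ q (i , j , a , i<s , s+2≤j) = i , j , Arc-++ q a , i<s , s+2≤j

  Blocked-∷ʳ⁻ : ∀ p c {s} → Blocked (p ++ c ∷ []) s →
                Blocked p s ⊎ (∃[ s′ ] LastOcc p c s′ × s′ < s × s + 2 ≤ length p)
  Blocked-∷ʳ⁻ p c (i , j , a , i<s , s+2≤j) with Arc-∷ʳ⁻ p c a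
  ... | inj₁ a′          = inj₁ (i , j , a′ , i<s , s+2≤j)
  ... | inj₂ (refl , l) = inj₂ (i , l , i<s , s+2≤j)

  Blocked⇒s+2<length : ∀ {p s} → Blocked p s → s + 2 < length p
  Blocked⇒s+2<length (i , j , a , _ , s+2≤j) = ≤-<-trans s+2≤j (j<∣p∣ a)

  Crossing-∷ʳ⁻ : ∀ p c → Crossing (p ++ c ∷ []) → Crossing p ⊎ (∃[ s ] LastOcc p c s × Blocked p s)
  Crossing-∷ʳ⁻ p c (crossing a₁ a₂ c₁ c₂ c₃) with Arc-∷ʳ⁻ p c a₁ | Arc-∷ʳ⁻ p c a₂
  ... | inj₂ (refl , _) | _ = contradiction (<-≤-trans c₃ (s≤s⁻¹ (subst (_ <_) (length-∷ʳ p c) (j<∣p∣ a₂)))) (<-irrefl refl)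
  ... | inj₁ b₁ | inj₁ b₂          = inj₁ (crossing b₁ b₂ c₁ c₂ c₃)
  ... | inj₁ b₁ | inj₂ (refl , l) = inj₂ (_ , l , _ , _ , b₁ , c₁ , c₂)

  Blocked⇒Crossing-∷ʳ : ∀ p c {s} → LastOcc p c s → Blocked p s → Crossing (p ++ c ∷ [])
  Blocked⇒Crossing-∷ʳ p c l (i , j , a , i<s , s+2≤j) =
    crossing (Arc-++ _ a) (LastOcc⇒Arc-∷ʳ p c l) i<s s+2≤j (j<∣p∣ a)

  -- The stack of open blocks

  dropThrough : ℕ → List ℕ → List ℕ
  dropThrough c []       = []
  dropThrough c (y ∷ ys) with c ≟ y
  ... | yes _ = ys
  ... | no  _ = dropThrough c ys

  reopen : List ℕ → ℕ → List ℕ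
  reopen []      c = c ∷ []
  reopen (t ∷ r) c with c ≟ t
  ... | yes _ = t ∷ r
  ... | no  _ = c ∷ t ∷ dropThrough c r

  dropThrough-here : ∀ c ys → dropThrough c (c ∷ ys) ≡ ys
  dropThrough-here c ys with c ≟ c
  ... | yes _  = refl
  ... | no c≢c = contradiction refl c≢c

  dropThrough-there : ∀ {c y} ys → c ≢ y → dropThrough c (y ∷ ys) ≡ dropThrough c ys
  dropThrough-there {c} {y} ys c≢y with c ≟ y
  ... | yes c≡y = contradiction c≡y c≢y
  ... | no  _   = refl

  reopen-top : ∀ t r → reopen (t ∷ r) t ≡ t ∷ r
  reopen-top t r with t ≟ t
  ... | yes _  = refl
  ... | no t≢t = contradiction refl t≢t

  reopen-below : ∀ {c t} r → c ≢ t → reopen (t ∷ r) c ≡ c ∷ t ∷ dropThrough c r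
  reopen-below {c} {t} r c≢t with c ≟ t
  ... | yes c≡t = contradiction c≡t c≢t
  ... | no  _   = refl

  dropThrough-⊆ : ∀ c r {x} → x ∈ dropThrough c r → x ∈ r
  dropThrough-⊆ c (y ∷ ys) x∈ with c ≟ y
  ... | yes _ = there x∈
  ... | no  _ = there (dropThrough-⊆ c ys x∈)

  module _ {R : ℕ → ℕ → Set} where

    dropThrough-below : ∀ c r {x} → AllPairs R r → c ∈ r → x ∈ dropThrough c r → R c x
    dropThrough-below c (y ∷ ys) (Ry ∷ R*) c∈ x∈ with c ≟ y
    dropThrough-below c (y ∷ ys) (Ry ∷ R*) _           x∈ | yes refl = All.lookup Ry x∈
    dropThrough-below c (y ∷ ys) (Ry ∷ R*) (here refl) x∈ | no c≢y   = contradiction refl c≢y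
    dropThrough-below c (y ∷ ys) (Ry ∷ R*) (there c∈)  x∈ | no _     = dropThrough-below c ys R* c∈ x∈

    dropped-above : ∀ c r {x} → AllPairs R r → c ∈ r → x ∈ r → x ∉ dropThrough c r → x ≢ c → R x c
    dropped-above c (y ∷ ys) (Ry ∷ R*) c∈ x∈ x∉ x≢c with c ≟ y
    dropped-above c (y ∷ ys) (Ry ∷ R*) _           (here refl) x∉ x≢c | yes refl = contradiction refl x≢c
    dropped-above c (y ∷ ys) (Ry ∷ R*) _           (there x∈)  x∉ x≢c | yes refl = contradiction x∈ x∉
    dropped-above c (y ∷ ys) (Ry ∷ R*) (here refl) _           x∉ x≢c | no c≢y   = contradiction refl c≢y
    dropped-above c (y ∷ ys) (Ry ∷ R*) (there c∈)  (here refl) x∉ x≢c | no _     = All.lookup Ry c∈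
    dropped-above c (y ∷ ys) (Ry ∷ R*) (there c∈)  (there x∈)  x∉ x≢c | no _     = dropped-above c ys R* c∈ x∈ x∉ x≢c

    AllPairs-dropThrough : ∀ c r → AllPairs R r → AllPairs R (dropThrough c r)
    AllPairs-dropThrough c []       R* = R*
    AllPairs-dropThrough c (y ∷ ys) (Ry ∷ R*) with c ≟ y
    ... | yes _ = R*
    ... | no  _ = AllPairs-dropThrough c ys R*

  AllPairs-map-within : ∀ {P : ℕ → Set} {R S : ℕ → ℕ → Set} {xs} →
                        (∀ {x y} → P x → P y → R x y → S x y) → All P xs → AllPairs R xs → AllPairs S xs
  AllPairs-map-within f []         []         = []
  AllPairs-map-within f (Px ∷ Pxs) (Rx ∷ R*) =
    All.tabulate (λ y∈ → f Px (All.lookup Pxs y∈) (All.lookup Rx y∈)) ∷ AllPairs-map-within f Pxs R*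

  Above : List ℕ → ℕ → ℕ → Set
  Above p x y = ∀ sx sy → LastOcc p x sx → LastOcc p y sy → sy < sx

  Above⇒≢ : ∀ {p x y s} → Above p x y → LastOcc p x s → x ≢ y
  Above⇒≢ x>y l refl = <-irrefl refl (x>y _ _ l l)

  Above-∷ʳ : ∀ p c {x y} → x ≢ c → y ≢ c → Above p x y → Above (p ++ c ∷ []) x y
  Above-∷ʳ p c x≢c y≢c x>y sx sy lx ly = x>y sx sy (LastOcc-∷ʳ⁻ p c x≢c lx) (LastOcc-∷ʳ⁻ p c y≢c ly)

  Above-∷ʳ-self : ∀ p c {y} → y ≢ c → Above (p ++ c ∷ []) c y
  Above-∷ʳ-self p c y≢c sx sy lx ly rewrite LastOcc-∷ʳ-self-unique p c lx = s<∣p∣ (LastOcc-∷ʳ⁻ p c y≢c ly)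

  TopIsLast : List ℕ → List ℕ → Set
  TopIsLast p []      = ⊤
  TopIsLast p (x ∷ _) = ∃[ s ] suc s ≡ length p × LastOcc p x s

  -- The open blocks st are those whose last element is not blocked, i.e. exactly
  -- the blocks the next letter may reuse; st lists them most recently used first.
  record StackInv (p st : List ℕ) (m : ℕ) : Set where
    field
      labels<        : ∀ i → i < length p → at p i < m
      occurs         : ∀ x → x < m → ∃ (LastOcc p x)
      open<          : All (_< m) st
      open⇒unblocked : ∀ {x s} → x ∈ st → LastOcc p x s → ¬ Blocked p s
      closed⇒blocked : ∀ {x s} → x < m → x ∉ st → LastOcc p x s → Blocked p s
      sorted         : AllPairs (Above p) st
      topIsLast      : TopIsLast p st
      noCrossing     : ¬ Crossing p
  open StackInv public

  StackInv-[] : StackInv [] [] 0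
  StackInv-[] = record
    { labels<        = λ _ ()
    ; occurs         = λ _ ()
    ; open<          = []
    ; open⇒unblocked = λ ()
    ; closed⇒blocked = λ ()
    ; sorted         = []
    ; topIsLast      = tt
    ; noCrossing     = λ c → n≮0 (j<∣p∣ (Crossing.arc₁ c)) }

  StackInv-unique : ∀ {p st m} → StackInv p st m → AllPairs _≢_ st
  StackInv-unique I =
    AllPairs-map-within (λ lx _ x>y → Above⇒≢ x>y (proj₂ lx))
      (All.map (occurs I _) (open< I)) (sorted I)

  labels<-∷ʳ : ∀ p c {m} → (∀ i → i < length p → at p i < m) → c < m →
               ∀ i → i < length (p ++ c ∷ []) → at (p ++ c ∷ []) i < m
  labels<-∷ʳ p c labels< c<m i i< with <-length-∷ʳ⁻ p c i<
  ... | inj₁ i<∣p∣ = subst (_< _) (sym (at-++ˡ p _ i<∣p∣)) (labels< i i<∣p∣)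
  ... | inj₂ refl  = subst (_< _) (sym (at-length p [] c)) c<m

  occurs-∷ʳ : ∀ p c {m} → (∀ x → x < m → ∃ (LastOcc p x)) → ∀ x → x < m → ∃ (LastOcc (p ++ c ∷ []) x)
  occurs-∷ʳ p c occurs x x<m with x ≟ c
  ... | yes refl = _ , LastOcc-∷ʳ-self p c
  ... | no x≢c   = _ , LastOcc-∷ʳ⁺ p c x≢c (proj₂ (occurs x x<m))

  Blocked-∷ʳ-near-end : ∀ p c {s} → length p ≤ suc s → ¬ Blocked (p ++ c ∷ []) s
  Blocked-∷ʳ-near-end p c {s} ∣p∣≤1+s b =
    1+n≰n (subst (_≤ suc s) (+-comm s 2) (≤-trans (s≤s⁻¹ s+2<∣pc∣) ∣p∣≤1+s))
    where s+2<∣pc∣ = subst (s + 2 <_) (length-∷ʳ p c) (Blocked⇒s+2<length b)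

  LastOcc-∷ʳ-self-unblocked : ∀ p c {s} → LastOcc (p ++ c ∷ []) c s → ¬ Blocked (p ++ c ∷ []) s
  LastOcc-∷ʳ-self-unblocked p c l rewrite LastOcc-∷ʳ-self-unique p c l = Blocked-∷ʳ-near-end p c (n≤1+n _)

  StackInv-new : ∀ {p st m} → StackInv p st m → StackInv (p ++ m ∷ []) (m ∷ st) (suc m)
  StackInv-new {p} {st} {m} I = record
    { labels<        = labels<-∷ʳ p m (λ i i< → m<n⇒m<1+n (labels< I i i<)) ≤-refl
    ; occurs         = occurs′
    ; open<          = ≤-refl ∷ All.map m<n⇒m<1+n (open< I)
    ; open⇒unblocked = unblocked′
    ; closed⇒blocked = blocked′
    ; sorted         = All.map (Above-∷ʳ-self p m) st≢m ∷ AllPairs-map-within (Above-∷ʳ p m) st≢m (sorted I)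
    ; topIsLast      = length p , sym (length-∷ʳ p m) , LastOcc-∷ʳ-self p m
    ; noCrossing     = noCrossing′ }
    where
    pm = p ++ m ∷ []
    st≢m = All.map <⇒≢ (open< I)
    fresh : ∀ {s} → ¬ LastOcc p m s
    fresh l = <-irrefl (at-s l) (labels< I _ (s<∣p∣ l))
    occurs′ : ∀ x → x < suc m → ∃ (LastOcc pm x)
    occurs′ x x< with x ≟ m
    ... | yes refl = _ , LastOcc-∷ʳ-self p m
    ... | no x≢m   = _ , LastOcc-∷ʳ⁺ p m x≢m (proj₂ (occurs I x (≤∧≢⇒< (s≤s⁻¹ x<) x≢m)))
    blocked⁻ : ∀ {s} → Blocked pm s → Blocked p s
    blocked⁻ b with Blocked-∷ʳ⁻ p m b
    ... | inj₁ b′           = b′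
    ... | inj₂ (_ , l , _) = contradiction l fresh
    noCrossing′ : ¬ Crossing pm
    noCrossing′ c with Crossing-∷ʳ⁻ p m c
    ... | inj₁ c′           = noCrossing I c′
    ... | inj₂ (_ , l , _) = fresh l
    unblocked′ : ∀ {x s} → x ∈ m ∷ st → LastOcc pm x s → ¬ Blocked pm s
    unblocked′ (here refl) l   = LastOcc-∷ʳ-self-unblocked p m l
    unblocked′ (there x∈)  l b =
      open⇒unblocked I x∈ (LastOcc-∷ʳ⁻ p m (<⇒≢ (All.lookup (open< I) x∈)) l) (blocked⁻ b)
    blocked′ : ∀ {x s} → x < suc m → x ∉ m ∷ st → LastOcc pm x s → Blocked pm s
    blocked′ x< x∉ l = Blocked-++ _
      (closed⇒blocked I (≤∧≢⇒< (s≤s⁻¹ x<) (x∉ ∘ here)) (x∉ ∘ there) (LastOcc-∷ʳ⁻ p m (x∉ ∘ here) l))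

  StackInv-top : ∀ {p t r m} → StackInv p (t ∷ r) m → StackInv (p ++ t ∷ []) (t ∷ r) m
  StackInv-top {p} {t} {r} {m} I with topIsLast I | sorted I | open< I
  ... | s₀ , s₀+1≡∣p∣ , l₀ | t>r ∷ r* | t<m ∷ _ = record
    { labels<        = labels<-∷ʳ p t (labels< I) t<m
    ; occurs         = occurs-∷ʳ p t (occurs I)
    ; open<          = open< I
    ; open⇒unblocked = unblocked′
    ; closed⇒blocked = blocked′
    ; sorted         = All.map (Above-∷ʳ-self p t) r≢t ∷ AllPairs-map-within (Above-∷ʳ p t) r≢t r*
    ; topIsLast      = length p , sym (length-∷ʳ p t) , LastOcc-∷ʳ-self p t
    ; noCrossing     = noCrossing′ }
    where
    pt = p ++ t ∷ []
    r≢t : All (_≢ t) r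
    r≢t = All.map (λ t>y y≡t → Above⇒≢ t>y l₀ (sym y≡t)) t>r
    -- The only new arc starts at the previous position, which blocks nothing.
    blocked⁻ : ∀ {s} → Blocked pt s → Blocked p s
    blocked⁻ b with Blocked-∷ʳ⁻ p t b
    ... | inj₁ b′ = b′
    ... | inj₂ (s′ , l , s′<s , s+2≤∣p∣) with LastOcc-unique l l₀
    ...   | refl = contradiction (≤-trans s+2≤∣p∣ (≤-reflexive (sym s₀+1≡∣p∣)))
                     λ s+2≤1+s₀ → m+1+n≰m _ (≤-trans s+2≤1+s₀ s′<s)
    noCrossing′ : ¬ Crossing pt
    noCrossing′ c with Crossing-∷ʳ⁻ p t c
    ... | inj₁ c′ = noCrossing I c′
    ... | inj₂ (s , l , b) with LastOcc-unique l l₀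
    ...   | refl = open⇒unblocked I (here refl) l₀ b
    unblocked′ : ∀ {x s} → x ∈ t ∷ r → LastOcc pt x s → ¬ Blocked pt s
    unblocked′ {x} x∈ l b with x ≟ t
    ... | yes refl = LastOcc-∷ʳ-self-unblocked p t l b
    ... | no x≢t   = open⇒unblocked I x∈ (LastOcc-∷ʳ⁻ p t x≢t l) (blocked⁻ b)
    blocked′ : ∀ {x s} → x < m → x ∉ t ∷ r → LastOcc pt x s → Blocked pt s
    blocked′ x<m x∉ l = Blocked-++ _ (closed⇒blocked I x<m x∉ (LastOcc-∷ʳ⁻ p t (x∉ ∘ here) l))

  StackInv-reopen : ∀ {p t r m c} → StackInv p (t ∷ r) m → c ∈ r → c ≢ t →
                    StackInv (p ++ c ∷ []) (c ∷ t ∷ dropThrough c r) m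
  StackInv-reopen {p} {t} {r} {m} {c} I c∈r c≢t with topIsLast I | sorted I
  ... | s₀ , s₀+1≡∣p∣ , l₀ | t>r ∷ r* = record
    { labels<        = labels<-∷ʳ p c (labels< I) c<m
    ; occurs         = occurs-∷ʳ p c (occurs I)
    ; open<          = c<m ∷ All.head (open< I) ∷ All.tabulate (λ x∈ → All.lookup (open< I) (there (dropThrough-⊆ c r x∈)))
    ; open⇒unblocked = unblocked′
    ; closed⇒blocked = blocked′
    ; sorted         = All.map (Above-∷ʳ-self p c) (t≢c ∷ d≢c)
                     ∷ All.tabulate (λ y∈ → Above-∷ʳ p c t≢c (All.lookup d≢c y∈) (All.lookup t>r (dropThrough-⊆ c r y∈)))
                     ∷ AllPairs-map-within (Above-∷ʳ p c) d≢c (AllPairs-dropThrough c r r*)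
    ; topIsLast      = length p , sym (length-∷ʳ p c) , LastOcc-∷ʳ-self p c
    ; noCrossing     = noCrossing′ }
    where
    pc = p ++ c ∷ []
    d = dropThrough c r
    c<m = All.lookup (open< I) (there c∈r)
    sc = proj₁ (occurs I c c<m)
    lc = proj₂ (occurs I c c<m)
    t≢c = c≢t ∘ sym
    d≢c : All (_≢ c) d
    d≢c = All.tabulate (λ x∈ x≡c → Above⇒≢ (dropThrough-below c r r* c∈r x∈) lc (sym x≡c))
    blocked⁻ : ∀ {s} → Blocked pc s → Blocked p s ⊎ sc < s
    blocked⁻ b with Blocked-∷ʳ⁻ p c b
    ... | inj₁ b′ = inj₁ b′
    ... | inj₂ (s′ , l , s′<s , _) with LastOcc-unique l lc
    ...   | refl = inj₂ s′<s
    noCrossing′ : ¬ Crossing pc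
    noCrossing′ x with Crossing-∷ʳ⁻ p c x
    ... | inj₁ x′ = noCrossing I x′
    ... | inj₂ (s , l , b) with LastOcc-unique l lc
    ...   | refl = open⇒unblocked I (there c∈r) lc b
    unblocked′ : ∀ {x s} → x ∈ c ∷ t ∷ d → LastOcc pc x s → ¬ Blocked pc s
    unblocked′ (here refl) l = LastOcc-∷ʳ-self-unblocked p c l
    unblocked′ (there (here refl)) l b with LastOcc-unique (LastOcc-∷ʳ⁻ p c t≢c l) l₀
    ... | refl = Blocked-∷ʳ-near-end p c (≤-reflexive (sym s₀+1≡∣p∣)) b
    unblocked′ (there (there x∈)) l b with blocked⁻ b
    ... | inj₁ b′   = open⇒unblocked I (there (dropThrough-⊆ c r x∈)) lx b′
      where lx = LastOcc-∷ʳ⁻ p c (All.lookup d≢c x∈) l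
    ... | inj₂ sc<s = <-asym sc<s (dropThrough-below c r r* c∈r x∈ sc _ lc lx)
      where lx = LastOcc-∷ʳ⁻ p c (All.lookup d≢c x∈) l
    -- A block that was open strictly between the top and c becomes blocked by
    -- the new arc ending at the last position.
    blocked′ : ∀ {x s} → x < m → x ∉ c ∷ t ∷ d → LastOcc pc x s → Blocked pc s
    blocked′ {x} {s} x<m x∉ l with x ∈? (t ∷ r)
    ... | no x∉′           = Blocked-++ _ (closed⇒blocked I x<m x∉′ (LastOcc-∷ʳ⁻ p c (x∉ ∘ here) l))
    ... | yes (here refl)  = contradiction (there (here refl)) x∉
    ... | yes (there x∈r) = sc , length p , LastOcc⇒Arc-∷ʳ p c lc , sc<s , s+2≤∣p∣
      where
      lx = LastOcc-∷ʳ⁻ p c (x∉ ∘ here) l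
      sc<s = dropped-above c r r* c∈r x∈r (x∉ ∘ there ∘ there) (x∉ ∘ here) s sc lx lc
      s<s₀ = All.lookup t>r x∈r s₀ s l₀ lx
      s+2≤∣p∣ = subst (s + 2 ≤_) s₀+1≡∣p∣ (subst (_≤ suc s₀) (+-comm 2 s) (s≤s s<s₀))

  reuseClosed⇒Crossing : ∀ {p st m c} → StackInv p st m → c < m → c ∉ st → Crossing (p ++ c ∷ [])
  reuseClosed⇒Crossing {p} {c = c} I c<m c∉ = Blocked⇒Crossing-∷ʳ p c l (closed⇒blocked I c<m c∉ l)
    where l = proj₂ (occurs I c c<m)

  -- Counting completions

  -- completions k r counts the ways to extend a prefix whose stack holds r open
  -- blocks by k letters without a 2-distant crossing.  A letter opens a new block
  -- (r + 1 open blocks afterwards), reuses the top (r), or reuses the block at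
  -- depth d ≥ 1 (r + 1 - d).
  mutual
    completions : ℕ → ℕ → ℕ
    completions zero    r = 1
    completions (suc k) r = completions k (suc r) + reuses k r

    reuses : ℕ → ℕ → ℕ
    reuses k zero    = 0
    reuses k (suc h) = completions k (suc h) + reusesBelowTop k h

    reusesBelowTop : ℕ → ℕ → ℕ
    reusesBelowTop k zero    = 0
    reusesBelowTop k (suc h) = reusesBelowTop k h + completions k (suc (suc h))

  sum-upTo-suc : ∀ (f : ℕ → ℕ) m → sum (map f (upTo (suc m))) ≡ sum (map f (upTo m)) + f m
  sum-upTo-suc f m = begin
    sum (map f (upTo (suc m)))        ≡⟨ cong (sum ∘ map f) (upTo-∷ʳ m) ⟨
    sum (map f (upTo m ++ m ∷ []))    ≡⟨ cong sum (map-++ f (upTo m) (m ∷ [])) ⟩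
    sum (map f (upTo m) ++ f m ∷ [])  ≡⟨ sum-++ (map f (upTo m)) (f m ∷ []) ⟩
    sum (map f (upTo m)) + (f m + 0)  ≡⟨ cong (sum (map f (upTo m)) +_) (+-identityʳ (f m)) ⟩
    sum (map f (upTo m)) + f m        ∎

  sum-upTo-cong : ∀ {f g : ℕ → ℕ} m → (∀ {c} → c < m → f c ≡ g c) → sum (map f (upTo m)) ≡ sum (map g (upTo m))
  sum-upTo-cong m f≡g = cong sum (map-cong-local (applyUpTo⁺₁ id m f≡g))

  sum-map-zero : ∀ {A : Set} (xs : List A) → sum (map (λ _ → 0) xs) ≡ 0
  sum-map-zero []       = refl
  sum-map-zero (x ∷ xs) = sum-map-zero xs

  sum-map-+ : ∀ {A : Set} (f g : A → ℕ) xs → sum (map (λ x → f x + g x) xs) ≡ sum (map f xs) + sum (map g xs)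
  sum-map-+ f g []       = refl
  sum-map-+ f g (x ∷ xs) =
    trans (cong (f x + g x +_) (sum-map-+ f g xs)) (interchange (f x) (g x) (sum (map f xs)) (sum (map g xs)))

  sum-upTo-single : ∀ (f : ℕ → ℕ) {y} m → y < m → sum (map (λ c → if c ≡ᵇ y then f c else 0) (upTo m)) ≡ f y
  sum-upTo-single f {y} (suc m) y<1+m with m≤n⇒m<n∨m≡n (s≤s⁻¹ y<1+m)
  ... | inj₁ y<m rewrite sum-upTo-suc (λ c → if c ≡ᵇ y then f c else 0) m | ≢⇒≡ᵇ-false (<⇒≢ y<m ∘ sym) =
    trans (+-identityʳ _) (sum-upTo-single f m y<m)
  ... | inj₂ refl rewrite sum-upTo-suc (λ c → if c ≡ᵇ y then f c else 0) m | ≡ᵇ-refl y =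
    cong (_+ f y) (trans (sum-upTo-cong m (λ {c} c<y → cong (if_then f c else 0) (≢⇒≡ᵇ-false (<⇒≢ c<y)))) (sum-map-zero (upTo m)))

  sum-upTo-indicator : ∀ (w : ℕ → ℕ) st m → AllPairs _≢_ st → All (_< m) st →
                  sum (map (λ c → if does (c ∈? st) then w c else 0) (upTo m)) ≡ sum (map w st)
  sum-upTo-indicator w []       m _             _           = sum-map-zero (upTo m)
  sum-upTo-indicator w (y ∷ ys) m (y∉ys ∷ ys*) (y<m ∷ ys<m) = begin
    sum (map (λ c → if does (c ∈? y ∷ ys) then w c else 0) (upTo m))
      ≡⟨ cong sum (map-cong split (upTo m)) ⟩
    sum (map (λ c → (if c ≡ᵇ y then w c else 0) + (if does (c ∈? ys) then w c else 0)) (upTo m))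
      ≡⟨ sum-map-+ _ _ (upTo m) ⟩
    sum (map (λ c → if c ≡ᵇ y then w c else 0) (upTo m)) + sum (map (λ c → if does (c ∈? ys) then w c else 0) (upTo m))
      ≡⟨ cong₂ _+_ (sum-upTo-single w m y<m) (sum-upTo-indicator w ys m ys* ys<m) ⟩
    w y + sum (map w ys) ∎
    where
    split : ∀ c → (if (c ≡ᵇ y) ∨ does (c ∈? ys) then w c else 0) ≡ (if c ≡ᵇ y then w c else 0) + (if does (c ∈? ys) then w c else 0)
    split c with c ≡ᵇ y in c≡ᵇy
    ... | false = refl
    ... | true with c ∈? ys
    ...   | no  _    = sym (+-identityʳ _)
    ...   | yes c∈ys = contradiction (sym (≡ᵇ⇒≡ c y (subst T (sym c≡ᵇy) _))) (All.lookup y∉ys c∈ys)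

  sum-dropThrough : ∀ k r → AllPairs _≢_ r →
                    sum (map (λ x → completions k (2 + length (dropThrough x r))) r) ≡ reusesBelowTop k (length r)
  sum-dropThrough k []       _             = refl
  sum-dropThrough k (y ∷ ys) (y∉ys ∷ ys*) =
    trans (cong₂ _+_ (cong (λ d → completions k (2 + length d)) (dropThrough-here y ys))
                     (trans (cong sum (map-cong-local (All.map (λ y≢x → cong (λ d → completions k (2 + length d))
                                                                             (dropThrough-there ys (y≢x ∘ sym))) y∉ys)))
                            (sum-dropThrough k ys ys*)))
          (+-comm (completions k (2 + length ys)) _)

  sum-reopen : ∀ k st → AllPairs _≢_ st → sum (map (λ c → completions k (length (reopen st c))) st) ≡ reuses k (length st)
  sum-reopen k []      _           = refl
  sum-reopen k (t ∷ r) (t∉r ∷ r*) =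
    cong₂ _+_ (cong (completions k ∘ length) (reopen-top t r))
              (trans (cong sum (map-cong-local (All.map (λ t≢x → cong (completions k ∘ length) (reopen-below r (t≢x ∘ sym))) t∉r)))
                     (sum-dropThrough k r r*))

  length-filterᵇ-concatMap : ∀ {A B : Set} (P : B → Bool) (φ : A → List B) xs →
                             length (filterᵇ P (concatMap φ xs)) ≡ sum (map (λ x → length (filterᵇ P (φ x))) xs)
  length-filterᵇ-concatMap P φ []       = refl
  length-filterᵇ-concatMap P φ (x ∷ xs) = begin
    length (filterᵇ P (φ x ++ concatMap φ xs))                    ≡⟨ cong length (filter-++ (T? ∘ P) (φ x) _) ⟩
    length (filterᵇ P (φ x) ++ filterᵇ P (concatMap φ xs))        ≡⟨ length-++ (filterᵇ P (φ x)) ⟩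
    length (filterᵇ P (φ x)) + length (filterᵇ P (concatMap φ xs)) ≡⟨ cong (_ +_) (length-filterᵇ-concatMap P φ xs) ⟩
    length (filterᵇ P (φ x)) + sum (map (λ x → length (filterᵇ P (φ x))) xs) ∎

  #completions : List ℕ → List (List ℕ) → ℕ
  #completions p ws = length (filterᵇ (λ w → kNoncrossing 2 (p ++ w)) ws)

  #completions-map-∷ : ∀ p c ws → #completions p (map (c ∷_) ws) ≡ #completions (p ++ c ∷ []) ws
  #completions-map-∷ p c []       = refl
  #completions-map-∷ p c (w ∷ ws) rewrite ++-assoc p (c ∷ []) w with kNoncrossing 2 (p ++ c ∷ w)
  ... | true  = cong suc (#completions-map-∷ p c ws)
  ... | false = #completions-map-∷ p c ws

  #completions-none : ∀ {p} → (∀ w → Crossing (p ++ w)) → ∀ ws → #completions p ws ≡ 0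
  #completions-none cross ws =
    cong length (filter-none (T? ∘ _) (All.universal (λ w → subst T (Crossing⇒kNoncrossing-false (cross w))) ws))

  #completions-rgsGo : ∀ k {p st m} → StackInv p st m → #completions p (rgsGo k m) ≡ completions k (length st)
  #completions-rgsGo zero {p} I rewrite ++-identityʳ p | ¬Crossing⇒kNoncrossing (noCrossing I) = refl
  #completions-rgsGo (suc k) {p} {st} {m} I = begin
    #completions p (rgsGo (suc k) m)
      ≡⟨ length-filterᵇ-concatMap _ (λ c → map (c ∷_) (rgsGo k (next c))) (upTo (suc m)) ⟩
    sum (map f (upTo (suc m)))
      ≡⟨ sum-upTo-suc f m ⟩
    sum (map f (upTo m)) + f m
      ≡⟨ cong₂ _+_ (sum-upTo-cong m reuse) newBlock ⟩
    sum (map (λ c → if does (c ∈? st) then w c else 0) (upTo m)) + completions k (suc (length st))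
      ≡⟨ cong (_+ completions k (suc (length st))) (sum-upTo-indicator w st m (StackInv-unique I) (open< I)) ⟩
    sum (map w st) + completions k (suc (length st))
      ≡⟨ cong (_+ completions k (suc (length st))) (sum-reopen k st (StackInv-unique I)) ⟩
    reuses k (length st) + completions k (suc (length st))
      ≡⟨ +-comm (reuses k (length st)) _ ⟩
    completions (suc k) (length st) ∎
    where
    next : ℕ → ℕ
    next c = if c ≡ᵇ m then suc m else m
    f : ℕ → ℕ
    f c = #completions p (map (c ∷_) (rgsGo k (next c)))
    w : ℕ → ℕ
    w c = completions k (length (reopen st c))
    newBlock : f m ≡ completions k (suc (length st))
    newBlock rewrite ≡ᵇ-refl m | #completions-map-∷ p m (rgsGo k (suc m)) = #completions-rgsGo k (StackInv-new I)
    reuseOpen : ∀ {st c} → StackInv p st m → c ∈ st → #completions (p ++ c ∷ []) (rgsGo k m) ≡ completions k (length (reopen st c))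
    reuseOpen {t ∷ r} {c} I′ c∈ with c ≟ t
    reuseOpen I′ _           | yes refl = #completions-rgsGo k (StackInv-top I′)
    reuseOpen I′ (here refl) | no c≢t   = contradiction refl c≢t
    reuseOpen I′ (there c∈r) | no c≢t   = #completions-rgsGo k (StackInv-reopen I′ c∈r c≢t)
    reuse : ∀ {c} → c < m → f c ≡ (if does (c ∈? st) then w c else 0)
    reuse {c} c<m rewrite ≢⇒≡ᵇ-false (<⇒≢ c<m) | #completions-map-∷ p c (rgsGo k m) with c ∈? st
    ... | no  c∉ = #completions-none (λ w → Crossing-++ w (reuseClosed⇒Crossing I c<m c∉)) (rgsGo k m)
    ... | yes c∈ = reuseOpen I c∈

  NCP₂≡completions : ∀ n → NCP 2 n ≡ completions n 0
  NCP₂≡completions n = #completions-rgsGo n StackInv-[]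

module PowerSeries where

  open import Data.Nat as ℕ using (ℕ; zero; suc; _∸_)
  open import Data.Integer using (ℤ; +_; _+_; _*_; -_)
  import Data.Integer.Properties as ℤ
  open import Data.List using (applyUpTo)
  open import Data.List.Properties using (map-upTo)
  open import Data.Maybe as Maybe using ()
  open import Data.Product using (_,_)
  open import Function using (_∘_)
  open import Level using (0ℓ)
  open import Relation.Binary.PropositionalEquality
  open import Relation.Nullary.Decidable using (dec⇒maybe)
  open import Algebra.Bundles using (CommutativeRing)
  open import Algebra.Structures using (IsCommutativeRing)
  open import Algebra.Solver.Ring.AlmostCommutativeRing
  open import Algebra.Properties.CommutativeSemigroup ℤ.+-commutativeSemigroup using (interchange)

  infix 4 _≈_
  _≈_ : FPS → FPS → Set
  f ≈ g = ∀ n → f n ≡ g n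

  ≈-refl : ∀ {f} → f ≈ f
  ≈-refl _ = refl

  ≈-sym : ∀ {f g} → f ≈ g → g ≈ f
  ≈-sym f≈g n = sym (f≈g n)

  ≈-trans : ∀ {f g h} → f ≈ g → g ≈ h → f ≈ h
  ≈-trans f≈g g≈h n = trans (f≈g n) (g≈h n)

  ⊕-cong : ∀ {f f′ g g′} → f ≈ f′ → g ≈ g′ → f ⊕ g ≈ f′ ⊕ g′
  ⊕-cong f≈f′ g≈g′ n = cong₂ _+_ (f≈f′ n) (g≈g′ n)

  antidiagonal : (ℕ → ℕ → ℤ) → ℕ → ℤ
  antidiagonal F zero    = F 0 0
  antidiagonal F (suc n) = F 0 (suc n) + antidiagonal (λ i j → F (suc i) j) n

  sumℤ-antidiagonal : ∀ (F : ℕ → ℕ → ℤ) n → sumℤ (applyUpTo (λ i → F i (n ∸ i)) (suc n)) ≡ antidiagonal F n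
  sumℤ-antidiagonal F zero    = ℤ.+-identityʳ (F 0 0)
  sumℤ-antidiagonal F (suc n) = cong (_+_ (F 0 (suc n))) (sumℤ-antidiagonal (λ i j → F (suc i) j) n)

  ⋆-antidiagonal : ∀ f g n → (f ⋆ g) n ≡ antidiagonal (λ i j → f i * g j) n
  ⋆-antidiagonal f g n =
    trans (cong sumℤ (map-upTo (λ i → f i * g (n ∸ i)) (suc n))) (sumℤ-antidiagonal (λ i j → f i * g j) n)

  antidiagonal-cong : ∀ {F G : ℕ → ℕ → ℤ} n → (∀ i j → i ℕ.+ j ≡ n → F i j ≡ G i j) → antidiagonal F n ≡ antidiagonal G n
  antidiagonal-cong zero    F≡G = F≡G 0 0 refl
  antidiagonal-cong (suc n) F≡G = cong₂ _+_ (F≡G 0 (suc n) refl) (antidiagonal-cong n (λ i j eq → F≡G (suc i) j (cong suc eq)))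

  antidiagonal-+ : ∀ (F G : ℕ → ℕ → ℤ) n → antidiagonal (λ i j → F i j + G i j) n ≡ antidiagonal F n + antidiagonal G n
  antidiagonal-+ F G zero    = refl
  antidiagonal-+ F G (suc n) =
    trans (cong (_+_ (F 0 (suc n) + G 0 (suc n))) (antidiagonal-+ (λ i j → F (suc i) j) (λ i j → G (suc i) j) n))
          (interchange (F 0 (suc n)) (G 0 (suc n)) _ _)

  antidiagonal-*ˡ : ∀ c (F : ℕ → ℕ → ℤ) n → antidiagonal (λ i j → c * F i j) n ≡ c * antidiagonal F n
  antidiagonal-*ˡ c F zero    = refl
  antidiagonal-*ˡ c F (suc n) =
    trans (cong (_+_ (c * F 0 (suc n))) (antidiagonal-*ˡ c (λ i j → F (suc i) j) n))
          (sym (ℤ.*-distribˡ-+ c (F 0 (suc n)) _))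

  antidiagonal-zero : ∀ n → antidiagonal (λ _ _ → + 0) n ≡ + 0
  antidiagonal-zero zero    = refl
  antidiagonal-zero (suc n) = trans (ℤ.+-identityˡ _) (antidiagonal-zero n)

  antidiagonal-last : ∀ (F : ℕ → ℕ → ℤ) n → antidiagonal F (suc n) ≡ antidiagonal (λ i j → F i (suc j)) n + F (suc n) 0
  antidiagonal-last F zero    = refl
  antidiagonal-last F (suc n) =
    trans (cong (_+_ (F 0 (suc (suc n)))) (antidiagonal-last (λ i j → F (suc i) j) n))
          (sym (ℤ.+-assoc (F 0 (suc (suc n))) _ _))

  antidiagonal-swap : ∀ (F : ℕ → ℕ → ℤ) n → antidiagonal F n ≡ antidiagonal (λ i j → F j i) n
  antidiagonal-swap F zero    = refl
  antidiagonal-swap F (suc n) = begin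
    F 0 (suc n) + antidiagonal (λ i j → F (suc i) j) n ≡⟨ cong (_+_ (F 0 (suc n))) (antidiagonal-swap (λ i j → F (suc i) j) n) ⟩
    F 0 (suc n) + antidiagonal (λ i j → F (suc j) i) n ≡⟨ ℤ.+-comm (F 0 (suc n)) _ ⟩
    antidiagonal (λ i j → F (suc j) i) n + F 0 (suc n) ≡⟨ antidiagonal-last (λ i j → F j i) n ⟨
    antidiagonal (λ i j → F j i) (suc n)               ∎
    where open ≡-Reasoning

  ⋆-at-0 : ∀ f g → (f ⋆ g) 0 ≡ f 0 * g 0
  ⋆-at-0 f g = ⋆-antidiagonal f g 0

  ⋆-at-suc : ∀ f g n → (f ⋆ g) (suc n) ≡ f 0 * g (suc n) + ((f ∘ suc) ⋆ g) n
  ⋆-at-suc f g n = trans (⋆-antidiagonal f g (suc n)) (cong (_+_ (f 0 * g (suc n))) (sym (⋆-antidiagonal (f ∘ suc) g n)))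

  ⋆-cong : ∀ {f f′ g g′} → f ≈ f′ → g ≈ g′ → f ⋆ g ≈ f′ ⋆ g′
  ⋆-cong {f} {f′} {g} {g′} f≈f′ g≈g′ n =
    trans (⋆-antidiagonal f g n)
      (trans (antidiagonal-cong n (λ i j _ → cong₂ _*_ (f≈f′ i) (g≈g′ j))) (sym (⋆-antidiagonal f′ g′ n)))

  ⋆-comm : ∀ f g → f ⋆ g ≈ g ⋆ f
  ⋆-comm f g n =
    trans (⋆-antidiagonal f g n) (trans (antidiagonal-swap _ n)
      (trans (antidiagonal-cong n (λ i j _ → ℤ.*-comm (f j) (g i))) (sym (⋆-antidiagonal g f n))))

  ⋆-distribˡ-⊕ : ∀ f g h → f ⋆ (g ⊕ h) ≈ (f ⋆ g) ⊕ (f ⋆ h)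
  ⋆-distribˡ-⊕ f g h n =
    trans (⋆-antidiagonal f (g ⊕ h) n)
      (trans (antidiagonal-cong n (λ i j _ → ℤ.*-distribˡ-+ (f i) (g j) (h j)))
        (trans (antidiagonal-+ _ _ n) (sym (cong₂ _+_ (⋆-antidiagonal f g n) (⋆-antidiagonal f h n)))))

  ⋆-distribʳ-⊕ : ∀ f g h → (g ⊕ h) ⋆ f ≈ (g ⋆ f) ⊕ (h ⋆ f)
  ⋆-distribʳ-⊕ f g h n =
    trans (⋆-comm (g ⊕ h) f n) (trans (⋆-distribˡ-⊕ f g h n) (cong₂ _+_ (⋆-comm f g n) (⋆-comm f h n)))

  ⋆-·ˡ : ∀ c f g → (c · f) ⋆ g ≈ c · (f ⋆ g)
  ⋆-·ˡ c f g n =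
    trans (⋆-antidiagonal (c · f) g n)
      (trans (antidiagonal-cong n (λ i j _ → ℤ.*-assoc c (f i) (g j)))
        (trans (antidiagonal-*ˡ c _ n) (cong (c *_) (sym (⋆-antidiagonal f g n)))))

  const⋆ : ∀ c f → const c ⋆ f ≈ c · f
  const⋆ c f zero    = ⋆-at-0 (const c) f
  const⋆ c f (suc n) =
    trans (⋆-at-suc (const c) f n)
      (trans (cong (_+_ (c * f (suc n))) (trans (⋆-antidiagonal (const c ∘ suc) f n)
                                             (trans (antidiagonal-cong n (λ i j _ → ℤ.*-zeroˡ (f j))) (antidiagonal-zero n))))
             (ℤ.+-identityʳ _))

  ⋆-identityˡ : ∀ f → const (+ 1) ⋆ f ≈ f
  ⋆-identityˡ f n = trans (const⋆ (+ 1) f n) (ℤ.*-identityˡ (f n))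

  ⋆-assoc : ∀ f g h → (f ⋆ g) ⋆ h ≈ f ⋆ (g ⋆ h)
  ⋆-assoc f g h zero =
    trans (⋆-at-0 (f ⋆ g) h) (trans (cong (_* h 0) (⋆-at-0 f g))
      (trans (ℤ.*-assoc (f 0) (g 0) (h 0)) (trans (cong (f 0 *_) (sym (⋆-at-0 g h))) (sym (⋆-at-0 f (g ⋆ h))))))
  ⋆-assoc f g h (suc n) = begin
    ((f ⋆ g) ⋆ h) (suc n)
      ≡⟨ ⋆-at-suc (f ⋆ g) h n ⟩
    (f ⋆ g) 0 * h (suc n) + (((f ⋆ g) ∘ suc) ⋆ h) n
      ≡⟨ cong₂ _+_ (cong (_* h (suc n)) (⋆-at-0 f g)) (⋆-cong {g = h} (⋆-at-suc f g) (λ _ → refl) n) ⟩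
    f 0 * g 0 * h (suc n) + (((f 0 · (g ∘ suc)) ⊕ ((f ∘ suc) ⋆ g)) ⋆ h) n
      ≡⟨ cong (_+_ (f 0 * g 0 * h (suc n))) (trans (⋆-distribʳ-⊕ h (f 0 · (g ∘ suc)) ((f ∘ suc) ⋆ g) n)
                                                (cong₂ _+_ (⋆-·ˡ (f 0) (g ∘ suc) h n) (⋆-assoc (f ∘ suc) g h n))) ⟩
    f 0 * g 0 * h (suc n) + (f 0 * ((g ∘ suc) ⋆ h) n + ((f ∘ suc) ⋆ (g ⋆ h)) n)
      ≡⟨ ℤ.+-assoc (f 0 * g 0 * h (suc n)) _ _ ⟨
    f 0 * g 0 * h (suc n) + f 0 * ((g ∘ suc) ⋆ h) n + ((f ∘ suc) ⋆ (g ⋆ h)) n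
      ≡⟨ cong (_+ ((f ∘ suc) ⋆ (g ⋆ h)) n) (trans (cong (_+ f 0 * ((g ∘ suc) ⋆ h) n) (ℤ.*-assoc (f 0) (g 0) (h (suc n))))
            (trans (sym (ℤ.*-distribˡ-+ (f 0) (g 0 * h (suc n)) _)) (cong (f 0 *_) (sym (⋆-at-suc g h n))))) ⟩
    f 0 * (g ⋆ h) (suc n) + ((f ∘ suc) ⋆ (g ⋆ h)) n
      ≡⟨ ⋆-at-suc f (g ⋆ h) n ⟨
    (f ⋆ (g ⋆ h)) (suc n) ∎
    where open ≡-Reasoning

  neg : FPS → FPS
  neg f n = - f n

  const-0 : ∀ n → const (+ 0) n ≡ + 0
  const-0 zero    = refl
  const-0 (suc n) = refl

  ⊕-⋆-isCommutativeRing : IsCommutativeRing _≈_ _⊕_ _⋆_ neg (const (+ 0)) (const (+ 1))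
  ⊕-⋆-isCommutativeRing = record
    { isRing = record
      { +-isAbelianGroup = record
        { isGroup = record
          { isMonoid = record
            { isSemigroup = record
              { isMagma = record
                { isEquivalence = record { refl = ≈-refl ; sym = ≈-sym ; trans = ≈-trans }
                ; ∙-cong = ⊕-cong }
              ; assoc = λ f g h n → ℤ.+-assoc (f n) (g n) (h n) }
            ; identity = (λ f n → trans (cong (_+ f n) (const-0 n)) (ℤ.+-identityˡ (f n)))
                       , (λ f n → trans (cong (_+_ (f n)) (const-0 n)) (ℤ.+-identityʳ (f n))) }
          ; inverse = (λ f n → trans (ℤ.+-inverseˡ (f n)) (sym (const-0 n)))
                    , (λ f n → trans (ℤ.+-inverseʳ (f n)) (sym (const-0 n)))
          ; ⁻¹-cong = λ e n → cong -_ (e n) }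
        ; comm = λ f g n → ℤ.+-comm (f n) (g n) }
      ; *-cong = ⋆-cong
      ; *-assoc = ⋆-assoc
      ; *-identity = ⋆-identityˡ , (λ f n → trans (⋆-comm f (const (+ 1)) n) (⋆-identityˡ f n))
      ; distrib = ⋆-distribˡ-⊕ , ⋆-distribʳ-⊕ }
    ; *-comm = ⋆-comm }

  ⊕-⋆-commutativeRing : CommutativeRing 0ℓ 0ℓ
  ⊕-⋆-commutativeRing = record { isCommutativeRing = ⊕-⋆-isCommutativeRing }

  ⊕-⋆-almostCommutativeRing : AlmostCommutativeRing 0ℓ 0ℓ
  ⊕-⋆-almostCommutativeRing = fromCommutativeRing ⊕-⋆-commutativeRing

  const-homomorphism : CommutativeRing.rawRing ℤ.+-*-commutativeRing -Raw-AlmostCommutative⟶ ⊕-⋆-almostCommutativeRing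
  const-homomorphism = record
    { ⟦_⟧    = const
    ; +-homo = λ a b → λ { zero → refl ; (suc n) → refl }
    ; *-homo = λ a b n → sym (trans (const⋆ a (const b) n) (const-· {a} {b} n))
    ; -‿homo = λ a → λ { zero → refl ; (suc n) → refl }
    ; 0-homo = λ { zero → refl ; (suc n) → refl }
    ; 1-homo = λ { zero → refl ; (suc n) → refl } }
    where
    const-· : ∀ {a b} n → (a · const b) n ≡ const (a * b) n
    const-· {a} zero    = refl
    const-· {a} (suc n) = ℤ.*-zeroʳ a

  open import Algebra.Solver.Ring (CommutativeRing.rawRing ℤ.+-*-commutativeRing) ⊕-⋆-almostCommutativeRing const-homomorphism
    (λ a b → Maybe.map (λ a≡b n → cong (λ c → const c n) a≡b) (dec⇒maybe (a ℤ.≟ b))) public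

module GeneratingFunction where

  open import Data.Nat as ℕ using (ℕ; zero; suc; _≡ᵇ_)
  import Data.Nat.Properties as ℕ
  open import Data.Integer as ℤ using (ℤ; +_; _+_; _*_)
  import Data.Integer.Properties as ℤ
  open import Data.Bool using (if_then_else_)
  open import Data.Product using (_×_; _,_; proj₁; proj₂)
  open import Data.Sum using (inj₁; inj₂)
  open import Function using (_∘_)
  open import Relation.Binary.PropositionalEquality as ≡ using (_≡_; _≢_; cong; cong₂)
  open import Algebra.Solver.Ring.AlmostCommutativeRing using (AlmostCommutativeRing)
  import Relation.Binary.Reasoning.Setoid
  open Counting using (completions; reusesBelowTop; NCP₂≡completions; ≡ᵇ-refl; ≢⇒≡ᵇ-false)
  open PowerSeries

  module ≈-Reasoning = Relation.Binary.Reasoning.Setoid (AlmostCommutativeRing.setoid ⊕-⋆-almostCommutativeRing)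

  1+X⋆-at-0 : ∀ f → (const (+ 1) ⊕ (X ⋆ f)) 0 ≡ + 1
  1+X⋆-at-0 f = cong (_+_ (+ 1)) (⋆-at-0 X f)

  1+X⋆-at-suc : ∀ f k → (const (+ 1) ⊕ (X ⋆ f)) (suc k) ≡ f k
  1+X⋆-at-suc f k = ≡.trans (ℤ.+-identityˡ _) (≡.trans (⋆-at-suc X f k)
    (≡.trans (ℤ.+-identityˡ _) (≡.trans (⋆-cong {g = f} X∘suc≈1 ≈-refl k) (⋆-identityˡ f k))))
    where
    X∘suc≈1 : X ∘ suc ≈ const (+ 1)
    X∘suc≈1 zero    = ≡.refl
    X∘suc≈1 (suc n) = ≡.refl

  ≈-1+X⋆ : ∀ {g} f → g 0 ≡ + 1 → (∀ k → g (suc k) ≡ f k) → g ≈ const (+ 1) ⊕ (X ⋆ f)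
  ≈-1+X⋆ f g₀ gₛ zero    = ≡.trans g₀ (≡.sym (1+X⋆-at-0 f))
  ≈-1+X⋆ f g₀ gₛ (suc k) = ≡.trans (gₛ k) (≡.sym (1+X⋆-at-suc f k))

  updateAt : FPS → ℕ → ℤ → FPS
  updateAt f n v i = if i ≡ᵇ n then v else f i

  updateAt-here : ∀ f n v → updateAt f n v n ≡ v
  updateAt-here f n v rewrite ≡ᵇ-refl n = ≡.refl

  updateAt-there : ∀ f {n i} v → i ≢ n → updateAt f n v i ≡ f i
  updateAt-there f v i≢n rewrite ≢⇒≡ᵇ-false i≢n = ≡.refl

  -- approx k holds the coefficients of degree ≤ k of the solution (P , B) of
  -- P = 1 + x (P + P B),  B = 1 + x P B,  which are determined degree by degree.
  approx : ℕ → FPS × FPS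
  approx zero    = (λ _ → + 1) , (λ _ → + 1)
  approx (suc k) = updateAt p (suc k) (p k + (p ⋆ b) k) , updateAt b (suc k) ((p ⋆ b) k)
    where p = proj₁ (approx k)
          b = proj₂ (approx k)

  P B : FPS
  P n = proj₁ (approx n) n
  B n = proj₂ (approx n) n

  approx-stable : ∀ k i → i ℕ.≤ k → proj₁ (approx k) i ≡ P i × proj₂ (approx k) i ≡ B i
  approx-stable zero    zero _   = ≡.refl , ≡.refl
  approx-stable (suc k) i  i≤1+k with ℕ.m≤n⇒m<n∨m≡n i≤1+k
  ... | inj₂ ≡.refl = ≡.refl , ≡.refl
  ... | inj₁ i<1+k = let (pᵢ , bᵢ) = approx-stable k i (ℕ.s≤s⁻¹ i<1+k) in
    ≡.trans (updateAt-there (proj₁ (approx k)) _ (ℕ.<⇒≢ i<1+k)) pᵢ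
    , ≡.trans (updateAt-there (proj₂ (approx k)) _ (ℕ.<⇒≢ i<1+k)) bᵢ

  approx-⋆ : ∀ k → (proj₁ (approx k) ⋆ proj₂ (approx k)) k ≡ (P ⋆ B) k
  approx-⋆ k = ≡.trans (⋆-antidiagonal (proj₁ (approx k)) (proj₂ (approx k)) k)
                      (≡.trans (antidiagonal-cong k stable) (≡.sym (⋆-antidiagonal P B k)))
    where
    stable : ∀ i j → i ℕ.+ j ≡ k → proj₁ (approx k) i * proj₂ (approx k) j ≡ P i * B j
    stable i j i+j≡k = cong₂ _*_ (proj₁ (approx-stable k i (ℕ.m+n≤o⇒m≤o i (ℕ.≤-reflexive i+j≡k))))
                                 (proj₂ (approx-stable k j (ℕ.m+n≤o⇒n≤o i (ℕ.≤-reflexive i+j≡k))))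

  P-equation : P ≈ const (+ 1) ⊕ (X ⋆ (P ⊕ (P ⋆ B)))
  P-equation = ≈-1+X⋆ (P ⊕ (P ⋆ B)) ≡.refl λ k →
    ≡.trans (updateAt-here (proj₁ (approx k)) (suc k) _)
            (cong₂ _+_ (proj₁ (approx-stable k k ℕ.≤-refl)) (approx-⋆ k))

  B-equation : B ≈ const (+ 1) ⊕ (X ⋆ (P ⋆ B))
  B-equation = ≈-1+X⋆ (P ⋆ B) ≡.refl λ k →
    ≡.trans (updateAt-here (proj₂ (approx k)) (suc k) _) (approx-⋆ k)

  pow : FPS → ℕ → FPS
  pow f zero    = const (+ 1)
  pow f (suc h) = f ⋆ pow f h

  G : ℕ → FPS
  G h = P ⋆ pow B h

  ΣG : ℕ → FPS
  ΣG zero    = const (+ 0)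
  ΣG (suc h) = ΣG h ⊕ G (suc h)

  ΣG-suc : ∀ h → ΣG (suc h) ≈ G 1 ⊕ (B ⋆ ΣG h)
  ΣG-suc zero = solve 2 (λ p b → con (+ 0) :+ p :* (b :* con (+ 1)) := p :* (b :* con (+ 1)) :+ b :* con (+ 0)) ≈-refl P B
  ΣG-suc (suc h) = begin
    (ΣG h ⊕ G (suc h)) ⊕ G (suc (suc h))
      ≈⟨ ⊕-cong (ΣG-suc h) ≈-refl ⟩
    (G 1 ⊕ (B ⋆ ΣG h)) ⊕ G (suc (suc h))
      ≈⟨ solve 4 (λ p b q s → (p :* (b :* con (+ 1)) :+ b :* s) :+ p :* (b :* (b :* q))
                             := p :* (b :* con (+ 1)) :+ b :* (s :+ p :* (b :* q))) ≈-refl P B (pow B h) (ΣG h) ⟩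
    G 1 ⊕ (B ⋆ (ΣG h ⊕ G (suc h))) ∎
    where open ≈-Reasoning

  -- The generating-function form of the recurrence for completions (suc k) (suc h).
  G-equation : ∀ h → G h ≈ const (+ 1) ⊕ (X ⋆ ((G (suc h) ⊕ G h) ⊕ ΣG h))
  G-equation zero = begin
    P ⋆ const (+ 1)
      ≈⟨ solve 1 (λ p → p :* con (+ 1) := p) ≈-refl P ⟩
    P
      ≈⟨ P-equation ⟩
    const (+ 1) ⊕ (X ⋆ (P ⊕ (P ⋆ B)))
      ≈⟨ solve 3 (λ x p b → con (+ 1) :+ x :* (p :+ p :* b)
                           := con (+ 1) :+ x :* ((p :* (b :* con (+ 1)) :+ p :* con (+ 1)) :+ con (+ 0))) ≈-refl X P B ⟩
    const (+ 1) ⊕ (X ⋆ ((G 1 ⊕ G 0) ⊕ ΣG 0)) ∎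
    where open ≈-Reasoning
  G-equation (suc h) = begin
    P ⋆ (B ⋆ Q)
      ≈⟨ solve 3 (λ p b q → p :* (b :* q) := b :* (p :* q)) ≈-refl P B Q ⟩
    B ⋆ (P ⋆ Q)
      ≈⟨ ⋆-cong {B} ≈-refl (G-equation h) ⟩
    B ⋆ (const (+ 1) ⊕ (X ⋆ (((P ⋆ (B ⋆ Q)) ⊕ (P ⋆ Q)) ⊕ S)))
      ≈⟨ solve 5 (λ x p b q s → b :* (con (+ 1) :+ x :* ((p :* (b :* q) :+ p :* q) :+ s))
                               := b :+ x :* ((p :* (b :* (b :* q)) :+ p :* (b :* q)) :+ b :* s)) ≈-refl X P B Q S ⟩
    B ⊕ (X ⋆ (((P ⋆ (B ⋆ (B ⋆ Q))) ⊕ (P ⋆ (B ⋆ Q))) ⊕ (B ⋆ S)))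
      ≈⟨ ⊕-cong B-equation ≈-refl ⟩
    (const (+ 1) ⊕ (X ⋆ (P ⋆ B))) ⊕ (X ⋆ (((P ⋆ (B ⋆ (B ⋆ Q))) ⊕ (P ⋆ (B ⋆ Q))) ⊕ (B ⋆ S)))
      ≈⟨ solve 5 (λ x p b q s → (con (+ 1) :+ x :* (p :* b)) :+ x :* ((p :* (b :* (b :* q)) :+ p :* (b :* q)) :+ b :* s)
                  := con (+ 1) :+ x :* ((p :* (b :* (b :* q)) :+ p :* (b :* q)) :+ (p :* (b :* con (+ 1)) :+ b :* s))) ≈-refl X P B Q S ⟩
    const (+ 1) ⊕ (X ⋆ ((G (suc (suc h)) ⊕ G (suc h)) ⊕ (G 1 ⊕ (B ⋆ S))))
      ≈⟨ ⊕-cong {const (+ 1)} ≈-refl (⋆-cong {X} ≈-refl (⊕-cong {G (suc (suc h)) ⊕ G (suc h)} ≈-refl (≈-sym (ΣG-suc h)))) ⟩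
    const (+ 1) ⊕ (X ⋆ ((G (suc (suc h)) ⊕ G (suc h)) ⊕ ΣG (suc h))) ∎
    where
    open ≈-Reasoning
    Q = pow B h
    S = ΣG h

  G-at-0 : ∀ h → G h 0 ≡ + 1
  G-at-0 h = ≡.trans (G-equation h 0) (1+X⋆-at-0 ((G (suc h) ⊕ G h) ⊕ ΣG h))

  G-at-suc : ∀ h k → G h (suc k) ≡ (G (suc h) k + G h k) + ΣG h k
  G-at-suc h k = ≡.trans (G-equation h (suc k)) (1+X⋆-at-suc ((G (suc h) ⊕ G h) ⊕ ΣG h) k)

  reusesBelowTop≡ΣG : ∀ k → (∀ h → + completions k (suc h) ≡ G h k) → ∀ h → + reusesBelowTop k h ≡ ΣG h k
  reusesBelowTop≡ΣG k IH zero    = ≡.sym (const-0 k)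
  reusesBelowTop≡ΣG k IH (suc h) =
    ≡.trans (ℤ.pos-+ (reusesBelowTop k h) _) (cong₂ _+_ (reusesBelowTop≡ΣG k IH h) (IH (suc h)))

  completions≡G : ∀ k h → + completions k (suc h) ≡ G h k
  completions≡G zero    h = ≡.sym (G-at-0 h)
  completions≡G (suc k) h = begin
    + (completions k (suc (suc h)) ℕ.+ (completions k (suc h) ℕ.+ reusesBelowTop k h))
      ≡⟨ ≡.trans (ℤ.pos-+ (completions k (suc (suc h))) _) (cong (_+_ (+ completions k (suc (suc h)))) (ℤ.pos-+ (completions k (suc h)) _)) ⟩
    + completions k (suc (suc h)) + (+ completions k (suc h) + + reusesBelowTop k h)
      ≡⟨ ℤ.+-assoc (+ completions k (suc (suc h))) (+ completions k (suc h)) (+ reusesBelowTop k h) ⟨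
    + completions k (suc (suc h)) + + completions k (suc h) + + reusesBelowTop k h
      ≡⟨ cong₂ _+_ (cong₂ _+_ (completions≡G k (suc h)) (completions≡G k h)) (reusesBelowTop≡ΣG k (completions≡G k) h) ⟩
    (G (suc h) k + G h k) + ΣG h k
      ≡⟨ G-at-suc h k ⟨
    G h (suc k) ∎
    where open ≡.≡-Reasoning

  genNCP₂-equation : genNCP 2 ≈ const (+ 1) ⊕ (X ⋆ P)
  genNCP₂-equation = ≈-1+X⋆ P (cong +_ (NCP₂≡completions 0)) λ k → begin
    + NCP 2 (suc k)                 ≡⟨ cong +_ (NCP₂≡completions (suc k)) ⟩
    + (completions k 1 ℕ.+ 0)       ≡⟨ cong +_ (ℕ.+-identityʳ _) ⟩
    + completions k 1               ≡⟨ completions≡G k 0 ⟩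
    (P ⋆ const (+ 1)) k             ≡⟨ ⋆-comm P (const (+ 1)) k ⟩
    (const (+ 1) ⋆ P) k             ≡⟨ ⋆-identityˡ P k ⟩
    P k                             ∎
    where open ≡.≡-Reasoning

  [1-X]⋆P≈B : (const (+ 1) ⊝ X) ⋆ P ≈ B
  [1-X]⋆P≈B = begin
    (const (+ 1) ⊝ X) ⋆ P                         ≈⟨ solve 2 (λ x p → (con (+ 1) :- x) :* p := p :- x :* p) ≈-refl X P ⟩
    P ⊝ (X ⋆ P)                                   ≈⟨ ⊕-cong P-equation ≈-refl ⟩
    (const (+ 1) ⊕ (X ⋆ (P ⊕ (P ⋆ B)))) ⊝ (X ⋆ P) ≈⟨ solve 3 (λ x p b → (con (+ 1) :+ x :* (p :+ p :* b)) :- x :* p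
                                                                  := con (+ 1) :+ x :* (p :* b)) ≈-refl X P B ⟩
    const (+ 1) ⊕ (X ⋆ (P ⋆ B))                   ≈⟨ ≈-sym B-equation ⟩
    B                                             ∎
    where open ≈-Reasoning

  [1-X⋆P]⋆B≈1 : (const (+ 1) ⊝ (X ⋆ P)) ⋆ B ≈ const (+ 1)
  [1-X⋆P]⋆B≈1 = begin
    (const (+ 1) ⊝ (X ⋆ P)) ⋆ B                   ≈⟨ solve 3 (λ x p b → (con (+ 1) :- x :* p) :* b := b :- x :* (p :* b)) ≈-refl X P B ⟩
    B ⊝ (X ⋆ (P ⋆ B))                             ≈⟨ ⊕-cong B-equation ≈-refl ⟩
    (const (+ 1) ⊕ (X ⋆ (P ⋆ B))) ⊝ (X ⋆ (P ⋆ B)) ≈⟨ solve 3 (λ x p b → (con (+ 1) :+ x :* (p :* b)) :- x :* (p :* b) := con (+ 1)) ≈-refl X P B ⟩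
    const (+ 1)                                   ∎
    where open ≈-Reasoning

  [1-X]⋆XP⋆[1-XP]≈X : (const (+ 1) ⊝ X) ⋆ ((X ⋆ P) ⋆ (const (+ 1) ⊝ (X ⋆ P))) ≈ X
  [1-X]⋆XP⋆[1-XP]≈X = begin
    (const (+ 1) ⊝ X) ⋆ ((X ⋆ P) ⋆ (const (+ 1) ⊝ (X ⋆ P)))
      ≈⟨ solve 2 (λ x p → (con (+ 1) :- x) :* ((x :* p) :* (con (+ 1) :- x :* p))
                          := x :* (((con (+ 1) :- x) :* p) :* (con (+ 1) :- x :* p))) ≈-refl X P ⟩
    X ⋆ (((const (+ 1) ⊝ X) ⋆ P) ⋆ (const (+ 1) ⊝ (X ⋆ P)))
      ≈⟨ ⋆-cong {X} ≈-refl (⋆-cong {g = const (+ 1) ⊝ (X ⋆ P)} [1-X]⋆P≈B ≈-refl) ⟩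
    X ⋆ (B ⋆ (const (+ 1) ⊝ (X ⋆ P)))
      ≈⟨ ⋆-cong {X} ≈-refl (⋆-comm B (const (+ 1) ⊝ (X ⋆ P))) ⟩
    X ⋆ ((const (+ 1) ⊝ (X ⋆ P)) ⋆ B)
      ≈⟨ ⋆-cong {X} ≈-refl [1-X⋆P]⋆B≈1 ⟩
    X ⋆ const (+ 1)
      ≈⟨ solve 1 (λ x → x :* con (+ 1) := x) ≈-refl X ⟩
    X ∎
    where open ≈-Reasoning

  ⊝-congʳ : ∀ f {g g′} → g ≈ g′ → f ⊝ g ≈ f ⊝ g′
  ⊝-congʳ f g≈g′ n = cong (ℤ._-_ (f n)) (g≈g′ n)

  ncp₂-square-root-equation : (const (+ 1) ⊝ X) ⋆ ((const (+ 3) ⊝ ((+ 2) · genNCP 2)) ⋆ (const (+ 3) ⊝ ((+ 2) · genNCP 2)))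
                            ≈ const (+ 1) ⊝ ((+ 5) · X)
  ncp₂-square-root-equation = begin
    (const (+ 1) ⊝ X) ⋆ (A ⋆ A)
      ≈⟨ ⋆-cong {const (+ 1) ⊝ X} ≈-refl (⋆-cong A≈ A≈) ⟩
    (const (+ 1) ⊝ X) ⋆ (A′ ⋆ A′)
      ≈⟨ solve 2 (λ x p → (con (+ 1) :- x) :* ((con (+ 3) :- con (+ 2) :* (con (+ 1) :+ x :* p)) :* (con (+ 3) :- con (+ 2) :* (con (+ 1) :+ x :* p)))
                          := (con (+ 1) :- x) :- con (+ 4) :* ((con (+ 1) :- x) :* ((x :* p) :* (con (+ 1) :- x :* p)))) ≈-refl X P ⟩
    (const (+ 1) ⊝ X) ⊝ (const (+ 4) ⋆ ((const (+ 1) ⊝ X) ⋆ ((X ⋆ P) ⋆ (const (+ 1) ⊝ (X ⋆ P)))))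
      ≈⟨ ⊝-congʳ (const (+ 1) ⊝ X) (⋆-cong {const (+ 4)} ≈-refl [1-X]⋆XP⋆[1-XP]≈X) ⟩
    (const (+ 1) ⊝ X) ⊝ (const (+ 4) ⋆ X)
      ≈⟨ solve 1 (λ x → (con (+ 1) :- x) :- con (+ 4) :* x := con (+ 1) :- con (+ 5) :* x) ≈-refl X ⟩
    const (+ 1) ⊝ (const (+ 5) ⋆ X)
      ≈⟨ ⊝-congʳ (const (+ 1)) (const⋆ (+ 5) X) ⟩
    const (+ 1) ⊝ ((+ 5) · X) ∎
    where
    open ≈-Reasoning
    A A′ : FPS
    A  = const (+ 3) ⊝ ((+ 2) · genNCP 2)
    A′ = const (+ 3) ⊝ (const (+ 2) ⋆ (const (+ 1) ⊕ (X ⋆ P)))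
    A≈ : A ≈ A′
    A≈ = ⊝-congʳ (const (+ 3)) λ n → ≡.trans (≡.sym (const⋆ (+ 2) (genNCP 2) n)) (⋆-cong {const (+ 2)} ≈-refl genNCP₂-equation n)

open import Data.Nat using (ℕ)
open import Data.List using ([]; _∷_; map; upTo)
open import Data.List.Properties using (map-cong)
open import Data.Product using (_×_; _,_)
open import Data.Integer using (+_)
open import Relation.Binary.PropositionalEquality using (_≡_; refl; trans)
open Counting using (NCP₂≡completions)
open GeneratingFunction using (ncp₂-square-root-equation)

mainTheorem6 : ((n : ℕ) → ((const (+ 1) ⊝ X) ⋆ ((const (+ 3) ⊝ ((+ 2) · genNCP 2)) ⋆ (const (+ 3) ⊝ ((+ 2) · genNCP 2)))) n ≡ (const (+ 1) ⊝ ((+ 5) · X)) n)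
    × (map (NCP 2) (upTo 9) ≡ 1 ∷ 1 ∷ 2 ∷ 5 ∷ 15 ∷ 51 ∷ 188 ∷ 731 ∷ 2950 ∷ [])
mainTheorem6 = ncp₂-square-root-equation , trans (map-cong NCP₂≡completions (upTo 9)) refl
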